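{- Let $G$ be a $B_2$-EPG graph with a fixed $B_2$-EPG representation, let $a,b$ be two rows, and let $G_{ab}$ be the set of vertices of $G$ whose index is exactly $\{a,b\}$. Then the subgraph of $G$ induced by $G_{ab}$ is a $2$-track interval graph.
   Context: An EPG representation of a graph $G$ assigns to every vertex $u$ a path $P_u$ in the rectangular grid, such that distinct $u,v$ are adjacent iff $P_u,P_v$ share a grid edge; a bend is a point where a path turns between horizontal and vertical; $G$ is $B_2$-EPG if some representation has every path with at most $2$ bends. Rows are horizontal grid lines. A vertex $u$ intersects a row if $P_u$ contains a grid edge of it; the index of $u$ is the set of rows it intersects. A $2$-track interval is the union of two intervals lying on two distinct lines (tracks); a $2$-track interval graph is the intersection graph of a family of $2$-track intervals on the same two tracks (equivalently, the edge-union of two interval graphs on the same vertex set). -}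

module Defs where

open import Data.Nat using (ℕ; zero; suc; _+_; _≤_)
open import Data.Integer as ℤ using (ℤ)
open import Data.Bool using (Bool; true; false; _xor_; if_then_else_)
open import Data.Product using (Σ; ∃; _×_; _,_; proj₁; proj₂)
open import Data.Sum using (_⊎_)
open import Data.Fin using (Fin)
open import Data.List using (List; []; _∷_; length)
open import Data.List.Relation.Unary.Linked using (Linked)
open import Data.List.Relation.Unary.Unique.Propositional using (Unique)
open import Relation.Nullary using (¬_)
open import Relation.Nullary.Decidable using (⌊_⌋)
open import Relation.Binary.PropositionalEquality using (_≡_; _≢_)
open import Function.Bundles using (_⇔_)

-- The rectangular grid: points are ℤ × ℤ (x = column, y = row).

Point : Set
Point = ℤ × ℤ

-- Grid edges (unoriented): hor x y joins (x,y)-(x+1,y) and lies on row y;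
-- ver x y joins (x,y)-(x,y+1).
data GridEdge : Set where
  hor : ℤ → ℤ → GridEdge
  ver : ℤ → ℤ → GridEdge

data Step : Point → Point → GridEdge → Set where
  right : ∀ x y → Step (x , y) (ℤ.suc x , y) (hor x y)
  left  : ∀ x y → Step (ℤ.suc x , y) (x , y) (hor x y)
  up    : ∀ x y → Step (x , y) (x , ℤ.suc y) (ver x y)
  down  : ∀ x y → Step (x , ℤ.suc y) (x , y) (ver x y)

GridAdj : Point → Point → Set
GridAdj p q = ∃ λ e → Step p q e

record GridPath : Set where
  field
    points  : List Point
    nontriv : 2 ≤ length points
    linked  : Linked GridAdj points
    simple  : Unique points
open GridPath public

data HasEdge : List Point → GridEdge → Set where
  here  : ∀ {p q ps e} → Step p q e → HasEdge (p ∷ q ∷ ps) e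
  there : ∀ {p ps e} → HasEdge ps e → HasEdge (p ∷ ps) e

ContainsEdge : GridPath → GridEdge → Set
ContainsEdge P e = HasEdge (points P) e

isHorizontalStep : Point → Point → Bool
isHorizontalStep p q = ⌊ proj₂ p ℤ.≟ proj₂ q ⌋

bendsList : List Point → ℕ
bendsList (p ∷ q ∷ r ∷ ps) =
  (if isHorizontalStep p q xor isHorizontalStep q r then 1 else 0)
  + bendsList (q ∷ r ∷ ps)
bendsList _ = 0

bends : GridPath → ℕ
bends P = bendsList (points P)

record Graph : Set₁ where
  field
    n      : ℕ
    Adj    : Fin n → Fin n → Set
    sym    : ∀ {u v} → Adj u v → Adj v u
    irrefl : ∀ {u} → ¬ Adj u u
open Graph public

record EPGRep (G : Graph) : Set₁ where
  field
    path    : Fin (n G) → GridPath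
    correct : ∀ u v → u ≢ v →
              Adj G u v ⇔ (∃ λ e → ContainsEdge (path u) e × ContainsEdge (path v) e)
open EPGRep public

IsBkRep : ℕ → {G : Graph} → EPGRep G → Set
IsBkRep k R = ∀ u → bends (path R u) ≤ k

IntersectsRow : {G : Graph} → EPGRep G → Fin (n G) → ℤ → Set
IntersectsRow R u y = ∃ λ x → ContainsEdge (path R u) (hor x y)

IndexIs : {G : Graph} → EPGRep G → Fin (n G) → ℤ → ℤ → Set
IndexIs R u a b = ∀ y → IntersectsRow R u y ⇔ (y ≡ a ⊎ y ≡ b)

record Interval : Set where
  constructor [_,_]⟨_⟩
  field
    lo   : ℤ
    hi   : ℤ
    lo≤hi : lo ℤ.≤ hi
open Interval public

Overlap : Interval → Interval → Set
Overlap I J = (lo I ℤ.≤ hi J) × (lo J ℤ.≤ hi I)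

InducedIsTwoTrackInterval : (G : Graph) → (Fin (n G) → Set) → Set
InducedIsTwoTrackInterval G S =
  Σ (Fin (n G) → Interval) λ I₁ →
  Σ (Fin (n G) → Interval) λ I₂ →
    ∀ u v → S u → S v → u ≢ v →
      Adj G u v ⇔ (Overlap (I₁ u) (I₁ v) ⊎ Overlap (I₂ u) (I₂ v))

-- A simple grid path is a word of unit steps with no immediate reversal, so its bends separate
-- maximal straight runs of alternating axis; with at most two bends there are at most three runs.
-- A path meeting two distinct rows a and b must then be horizontal-vertical-horizontal: a segment
-- on row a and a segment on row b, both ending at the column c of the vertical run joining the two
-- rows. Two such paths share a vertical edge iff they have the same column, and a horizontal edge
-- iff their segments on row a (or on row b) share a unit. Measured in half units, shorten each
-- horizontal segment by half a unit at its free end: the resulting intervals meet iff the segments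
-- share a unit or bend at the same column. The segments on rows a and b give the two tracks.

module Submission where

open import Defs hiding (sym)
open import Data.Bool using (Bool; true; false; _xor_; if_then_else_)
open import Data.Bool.Properties using (xor-same)
open import Data.Integer as ℤ using (ℤ; _<_; _≤_; _⊓_)
import Data.Integer.Properties as ℤ
open import Data.List using (List; []; _∷_; _++_; replicate; map)
open import Data.List.Membership.Propositional using (_∈_)
open import Data.List.Membership.Propositional.Properties
  using (∈-map⁺; ∈-map⁻; ∈-++⁻; ∈-++⁺ˡ; ∈-++⁺ʳ)
open import Data.List.Relation.Unary.Any using (here; there)
open import Data.List.Relation.Unary.All using (_∷_)
open import Data.List.Relation.Unary.AllPairs using (_∷_)
open import Data.List.Relation.Unary.Unique.Propositional using (Unique)
open import Data.List.Relation.Unary.Linked as Linked using (Linked; []; [-]; _∷_)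
open import Data.Fin using (Fin)
open import Data.Nat as ℕ using (ℕ; zero; suc)
open import Data.Nat.Properties using (n≮0)
open import Data.Product using (Σ; ∃; ∃₂; _×_; _,_; proj₁; proj₂)
open import Data.Product.Properties using (,-injectiveˡ; ,-injectiveʳ)
open import Data.Sum using (_⊎_; inj₁; inj₂)
import Data.Sum
open import Data.Empty using (⊥-elim)
open import Function using (_∘_; case_of_)
open import Function.Properties.Equivalence using () renaming (refl to ⇔-refl; sym to ⇔-sym; trans to ⇔-trans)
open import Data.Sum.Function.Propositional using (_⊎-⇔_)
open import Function.Bundles using (_⇔_; mk⇔; Equivalence)
open import Relation.Nullary using (¬_; yes; no)
open import Relation.Nullary.Decidable using (isYes≗does; dec-true; dec-false)
open import Relation.Binary.PropositionalEquality
  using (_≡_; _≢_; refl; sym; trans; cong; cong₂; subst)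

-- Grid directions

data Axis : Set where
  horizontal vertical : Axis

data Sign : Set where
  plus minus : Sign

Dir : Set
Dir = Axis × Sign

flip : Sign → Sign
flip plus = minus
flip minus = plus

reverse : Dir → Dir
reverse (ax , s) = ax , flip s

other : Axis → Axis
other horizontal = vertical
other vertical = horizontal

other-involutive : ∀ ax → other (other ax) ≡ ax
other-involutive horizontal = refl
other-involutive vertical = refl

isHorizontal : Dir → Bool
isHorizontal (horizontal , _) = true
isHorizontal (vertical , _) = false

shift : Sign → ℤ → ℤ
shift plus = ℤ.suc
shift minus = ℤ.pred

t<suc[t] : ∀ t → t < ℤ.suc t
t<suc[t] t = ℤ.suc[i]≤j⇒i<j ℤ.≤-refl

pred[t]<t : ∀ t → ℤ.pred t < t
pred[t]<t t = ℤ.i≤pred[j]⇒i<j ℤ.≤-refl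

pred[t]<suc[t] : ∀ t → ℤ.pred t < ℤ.suc t
pred[t]<suc[t] t = ℤ.<-trans (pred[t]<t t) (t<suc[t] t)

shift-≢ : ∀ s t → shift s t ≢ t
shift-≢ plus t = ℤ.<⇒≢ (t<suc[t] t) ∘ sym
shift-≢ minus t = ℤ.<⇒≢ (pred[t]<t t)

shift-injective : ∀ {s s'} t → shift s t ≡ shift s' t → s ≡ s'
shift-injective {plus} {plus} t _ = refl
shift-injective {minus} {minus} t _ = refl
shift-injective {plus} {minus} t eq = ⊥-elim (ℤ.<⇒≢ (pred[t]<suc[t] t) (sym eq))
shift-injective {minus} {plus} t eq = ⊥-elim (ℤ.<⇒≢ (pred[t]<suc[t] t) eq)

-- A step in direction s from coordinate t traverses the unit [unitOf s t, unitOf s t + 1].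
unitOf : Sign → ℤ → ℤ
unitOf plus t = t
unitOf minus t = ℤ.pred t

along across : Axis → Point → ℤ
along horizontal = proj₁
along vertical = proj₂
across horizontal = proj₂
across vertical = proj₁

pointAt : Axis → ℤ → ℤ → Point
pointAt horizontal t c = t , c
pointAt vertical t c = c , t

unitEdge : Axis → ℤ → ℤ → GridEdge
unitEdge horizontal t c = hor t c
unitEdge vertical t c = ver c t

move : Dir → Point → Point
move (ax , s) p = pointAt ax (shift s (along ax p)) (across ax p)

edge : Dir → Point → GridEdge
edge (ax , s) p = unitEdge ax (unitOf s (along ax p)) (across ax p)

step⇒dir : ∀ {p q e} → Step p q e → Σ Dir λ d → q ≡ move d p × e ≡ edge d p
step⇒dir (right x y) = (horizontal , plus) , refl , refl
step⇒dir (left x y) =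
  (horizontal , minus) , cong (_, y) (sym (ℤ.pred-suc x)) , cong (λ z → hor z y) (sym (ℤ.pred-suc x))
step⇒dir (up x y) = (vertical , plus) , refl , refl
step⇒dir (down x y) =
  (vertical , minus) , cong (x ,_) (sym (ℤ.pred-suc y)) , cong (ver x) (sym (ℤ.pred-suc y))

dir⇒step : ∀ d p → Step p (move d p) (edge d p)
dir⇒step (horizontal , plus) (x , y) = right x y
dir⇒step (horizontal , minus) (x , y) =
  subst (λ z → Step (z , y) (ℤ.pred x , y) (hor (ℤ.pred x) y)) (ℤ.suc-pred x) (left (ℤ.pred x) y)
dir⇒step (vertical , plus) (x , y) = up x y
dir⇒step (vertical , minus) (x , y) =
  subst (λ z → Step (x , z) (x , ℤ.pred y) (ver x (ℤ.pred y))) (ℤ.suc-pred y) (down x (ℤ.pred y))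

move-injective : ∀ {d d'} p → move d p ≡ move d' p → d ≡ d'
move-injective {horizontal , s} {horizontal , s'} (x , y) eq =
  cong (horizontal ,_) (shift-injective x (,-injectiveˡ eq))
move-injective {vertical , s} {vertical , s'} (x , y) eq =
  cong (vertical ,_) (shift-injective y (,-injectiveʳ eq))
move-injective {horizontal , s} {vertical , s'} (x , y) eq = ⊥-elim (shift-≢ s x (,-injectiveˡ eq))
move-injective {vertical , s} {horizontal , s'} (x , y) eq = ⊥-elim (shift-≢ s' x (sym (,-injectiveˡ eq)))

step-edge : ∀ d {p e} → Step p (move d p) e → e ≡ edge d p
step-edge d {p} st with step⇒dir st
... | d' , q≡ , e≡ with move-injective {d} {d'} p q≡
... | refl = e≡

move-reverse : ∀ d p → move (reverse d) (move d p) ≡ p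
move-reverse (horizontal , plus) (x , y) = cong (_, y) (ℤ.pred-suc x)
move-reverse (horizontal , minus) (x , y) = cong (_, y) (ℤ.suc-pred x)
move-reverse (vertical , plus) (x , y) = cong (x ,_) (ℤ.pred-suc y)
move-reverse (vertical , minus) (x , y) = cong (x ,_) (ℤ.suc-pred y)

isHorizontalStep-move : ∀ d p → isHorizontalStep p (move d p) ≡ isHorizontal d
isHorizontalStep-move (horizontal , s) (x , y) =
  trans (isYes≗does (y ℤ.≟ y)) (dec-true (y ℤ.≟ y) refl)
isHorizontalStep-move (vertical , s) (x , y) =
  trans (isYes≗does (y ℤ.≟ shift s y)) (dec-false (y ℤ.≟ shift s y) (shift-≢ s y ∘ sym))

-- Paths as words of directions

trace⁺ : Point → List Dir → List Point
trace⁺ p [] = []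
trace⁺ p (d ∷ ds) = move d p ∷ trace⁺ (move d p) ds

trace : Point → List Dir → List Point
trace p ds = p ∷ trace⁺ p ds

edgesAlong : Point → List Dir → List GridEdge
edgesAlong p [] = []
edgesAlong p (d ∷ ds) = edge d p ∷ edgesAlong (move d p) ds

endpoint : Point → List Dir → Point
endpoint p [] = p
endpoint p (d ∷ ds) = endpoint (move d p) ds

hasEdge⇔∈ : ∀ p ds {e} → HasEdge (trace p ds) e ⇔ e ∈ edgesAlong p ds
hasEdge⇔∈ p ds = mk⇔ (to p ds) (from p ds)
  where
  to : ∀ p ds {e} → HasEdge (trace p ds) e → e ∈ edgesAlong p ds
  to p [] (there ())
  to p (d ∷ ds) (here st) = here (step-edge d st)
  to p (d ∷ ds) (there h) = there (to (move d p) ds h)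
  from : ∀ p ds {e} → e ∈ edgesAlong p ds → HasEdge (trace p ds) e
  from p (d ∷ ds) (here refl) = here (dir⇒step d p)
  from p (d ∷ ds) (there e∈) = there (from (move d p) ds e∈)

linked⇒trace : ∀ {p ps} → Linked GridAdj (p ∷ ps) → ∃ λ ds → p ∷ ps ≡ trace p ds
linked⇒trace {ps = []} _ = [] , refl
linked⇒trace {p} {q ∷ ps} ((_ , st) ∷ adj) with step⇒dir st
... | d , refl , _ with linked⇒trace adj
... | ds , eq = d ∷ ds , cong (p ∷_) eq

NoReversal : List Dir → Set
NoReversal = Linked (λ d d' → d' ≢ reverse d)

unique⇒noReversal : ∀ p ds → Unique (trace p ds) → NoReversal ds
unique⇒noReversal p [] _ = []
unique⇒noReversal p (d ∷ []) _ = [-]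
unique⇒noReversal p (d ∷ d' ∷ ds) ((_ ∷ p≢p'' ∷ _) ∷ unique) =
  (λ { refl → p≢p'' (sym (move-reverse d p)) }) ∷ unique⇒noReversal (move d p) (d' ∷ ds) unique

bendsAlong : List Dir → ℕ
bendsAlong (d ∷ d' ∷ ds) = (if isHorizontal d xor isHorizontal d' then 1 else 0) ℕ.+ bendsAlong (d' ∷ ds)
bendsAlong _ = 0

bendsList-trace : ∀ p ds → bendsList (trace p ds) ≡ bendsAlong ds
bendsList-trace p [] = refl
bendsList-trace p (d ∷ []) = refl
bendsList-trace p (d ∷ d' ∷ ds) =
  cong₂ (λ b k → (if b then 1 else 0) ℕ.+ k)
    (cong₂ _xor_ (isHorizontalStep-move d p) (isHorizontalStep-move d' (move d p)))
    (bendsList-trace (move d p) (d' ∷ ds))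

-- Decomposition into straight runs

run : ℕ → Dir → List Dir
run k d = replicate (suc k) d

data Continues (d : Dir) : Dir → Set where
  straight : Continues d d
  turn : ∀ s → Continues d (other (proj₁ d) , s)

continues-sameAxis : ∀ {ax} s s' → (ax , s') ≢ (ax , flip s) → Continues (ax , s) (ax , s')
continues-sameAxis plus plus _ = straight
continues-sameAxis minus minus _ = straight
continues-sameAxis plus minus reversal = ⊥-elim (reversal refl)
continues-sameAxis minus plus reversal = ⊥-elim (reversal refl)

continues : ∀ d d' → d' ≢ reverse d → Continues d d'
continues (horizontal , s) (horizontal , s') = continues-sameAxis s s'
continues (vertical , s) (vertical , s') = continues-sameAxis s s'
continues (horizontal , s) (vertical , s') _ = turn s'
continues (vertical , s) (horizontal , s') _ = turn s'

data LeadingRun (d : Dir) : List Dir → Set where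
  whole : ∀ k → LeadingRun d (run k d)
  turns : ∀ k s ds → LeadingRun d (run k d ++ (other (proj₁ d) , s) ∷ ds)

leadingRun : ∀ {d} ds → NoReversal (d ∷ ds) → LeadingRun d (d ∷ ds)
leadingRun [] _ = whole 0
leadingRun {d} (d' ∷ ds) (noRev ∷ noRevs) with continues d d' noRev
... | straight = extend (leadingRun ds noRevs)
  where
  extend : ∀ {ds} → LeadingRun d ds → LeadingRun d (d ∷ ds)
  extend (whole k) = whole (suc k)
  extend (turns k s ds) = turns (suc k) s ds
... | turn s = turns 0 s ds

linked-++⁻ʳ : ∀ {A : Set} {R : A → A → Set} xs {ys} → Linked R (xs ++ ys) → Linked R ys
linked-++⁻ʳ [] linked = linked
linked-++⁻ʳ (x ∷ xs) linked = linked-++⁻ʳ xs (Linked.tail linked)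

bends-run : ∀ k d rest → bendsAlong (run k d ++ rest) ≡ bendsAlong (d ∷ rest)
bends-run zero d rest = refl
bends-run (suc k) d rest =
  trans (cong (λ b → (if b then 1 else 0) ℕ.+ bendsAlong (run k d ++ rest)) (xor-same (isHorizontal d)))
        (bends-run k d rest)

bends-turns : ∀ k ax s s' ds →
  bendsAlong (run k (ax , s) ++ (other ax , s') ∷ ds) ≡ suc (bendsAlong ((other ax , s') ∷ ds))
bends-turns k horizontal s s' ds = bends-run k _ _
bends-turns k vertical s s' ds = bends-run k _ _

data AtMostThreeRuns : List Dir → Set where
  none : AtMostThreeRuns []
  one : ∀ ax s k → AtMostThreeRuns (run k (ax , s))
  two : ∀ ax s₁ s₂ k₁ k₂ → AtMostThreeRuns (run k₁ (ax , s₁) ++ run k₂ (other ax , s₂))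
  three : ∀ ax s₁ s₂ s₃ k₁ k₂ k₃ →
    AtMostThreeRuns (run k₁ (ax , s₁) ++ run k₂ (other ax , s₂) ++ run k₃ (ax , s₃))

bends-afterTurn : ∀ k ax s s' ds {b} → bendsAlong (run k (ax , s) ++ (other ax , s') ∷ ds) ℕ.≤ suc b →
  bendsAlong ((other ax , s') ∷ ds) ℕ.≤ b
bends-afterTurn k ax s s' ds bounded = ℕ.s≤s⁻¹ (subst (ℕ._≤ _) (bends-turns k ax s s' ds) bounded)

atMostThreeRuns : ∀ ds → NoReversal ds → bendsAlong ds ℕ.≤ 2 → AtMostThreeRuns ds
atMostThreeRuns [] _ _ = none
atMostThreeRuns ((ax , s₁) ∷ ds) noRev bends with leadingRun ds noRev
... | whole k₁ = one ax s₁ k₁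
... | turns k₁ s₂ ds₂ with leadingRun ds₂ (linked-++⁻ʳ (run k₁ _) noRev)
...   | whole k₂ = two ax s₁ s₂ k₁ k₂
...   | turns k₂ s₃ ds₃ with leadingRun ds₃ (linked-++⁻ʳ (run k₂ _) (linked-++⁻ʳ (run k₁ _) noRev))
...     | whole k₃ rewrite other-involutive ax = three ax s₁ s₂ s₃ k₁ k₂ k₃
...     | turns k₃ s₄ ds₄ = ⊥-elim (n≮0 (subst (ℕ._≤ 0) (bends-turns k₃ _ s₃ s₄ ds₄)
                            (bends-afterTurn k₂ (other ax) s₂ s₃ _ (bends-afterTurn k₁ ax s₁ s₂ _ bends))))

-- Edges of a straight run

shiftBy : Sign → ℕ → ℤ → ℤ
shiftBy s zero t = t
shiftBy s (suc k) t = shiftBy s k (shift s t)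

units : Sign → ℤ → ℕ → List ℤ
units s t zero = []
units s t (suc k) = unitOf s t ∷ units s (shift s t) k

edgesAlong-replicate : ∀ ax s p k →
  edgesAlong p (replicate k (ax , s)) ≡ map (λ u → unitEdge ax u (across ax p)) (units s (along ax p) k)
edgesAlong-replicate ax s p zero = refl
edgesAlong-replicate horizontal s (x , y) (suc k) =
  cong (hor (unitOf s x) y ∷_) (edgesAlong-replicate horizontal s (shift s x , y) k)
edgesAlong-replicate vertical s (x , y) (suc k) =
  cong (ver x (unitOf s y) ∷_) (edgesAlong-replicate vertical s (x , shift s y) k)

endpoint-replicate : ∀ ax s p k →
  endpoint p (replicate k (ax , s)) ≡ pointAt ax (shiftBy s k (along ax p)) (across ax p)
endpoint-replicate horizontal s p zero = refl
endpoint-replicate vertical s p zero = refl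
endpoint-replicate horizontal s (x , y) (suc k) = endpoint-replicate horizontal s (shift s x , y) k
endpoint-replicate vertical s (x , y) (suc k) = endpoint-replicate vertical s (x , shift s y) k

edgesAlong-++ : ∀ p xs ys → edgesAlong p (xs ++ ys) ≡ edgesAlong p xs ++ edgesAlong (endpoint p xs) ys
edgesAlong-++ p [] ys = refl
edgesAlong-++ p (d ∷ xs) ys = cong (edge d p ∷_) (edgesAlong-++ (move d p) xs ys)

t≤shiftBy⁺ : ∀ k t → t ≤ shiftBy plus k t
t≤shiftBy⁺ zero t = ℤ.≤-refl
t≤shiftBy⁺ (suc k) t = ℤ.≤-trans (ℤ.<⇒≤ (t<suc[t] t)) (t≤shiftBy⁺ k (ℤ.suc t))

shiftBy⁻≤t : ∀ k t → shiftBy minus k t ≤ t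
shiftBy⁻≤t zero t = ℤ.≤-refl
shiftBy⁻≤t (suc k) t = ℤ.≤-trans (shiftBy⁻≤t k (ℤ.pred t)) (ℤ.<⇒≤ (pred[t]<t t))

t<shiftBy⁺ : ∀ k t → t < shiftBy plus (suc k) t
t<shiftBy⁺ k t = ℤ.<-≤-trans (t<suc[t] t) (t≤shiftBy⁺ k (ℤ.suc t))

shiftBy⁻<t : ∀ k t → shiftBy minus (suc k) t < t
shiftBy⁻<t k t = ℤ.≤-<-trans (shiftBy⁻≤t k (ℤ.pred t)) (pred[t]<t t)

∈-units⁺ : ∀ k t {u} → u ∈ units plus t k ⇔ (t ≤ u × u < shiftBy plus k t)
∈-units⁺ zero t = mk⇔ (λ ()) (λ (t≤u , u<t) → ⊥-elim (ℤ.<-irrefl refl (ℤ.≤-<-trans t≤u u<t)))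
∈-units⁺ (suc k) t {u} = mk⇔ to from
  where
  to : u ∈ units plus t (suc k) → t ≤ u × u < shiftBy plus (suc k) t
  to (here refl) = ℤ.≤-refl , t<shiftBy⁺ k t
  to (there u∈) with Equivalence.to (∈-units⁺ k (ℤ.suc t)) u∈
  ... | suc[t]≤u , u<end = ℤ.<⇒≤ (ℤ.suc[i]≤j⇒i<j suc[t]≤u) , u<end
  from : t ≤ u × u < shiftBy plus (suc k) t → u ∈ units plus t (suc k)
  from (t≤u , u<end) with t ℤ.≟ u
  ... | yes refl = here refl
  ... | no t≢u =
    there (Equivalence.from (∈-units⁺ k (ℤ.suc t)) (ℤ.i<j⇒suc[i]≤j (ℤ.≤∧≢⇒< t≤u t≢u) , u<end))

∈-units⁻ : ∀ k t {u} → u ∈ units minus t k ⇔ (shiftBy minus k t ≤ u × u < t)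
∈-units⁻ zero t = mk⇔ (λ ()) (λ (t≤u , u<t) → ⊥-elim (ℤ.<-irrefl refl (ℤ.≤-<-trans t≤u u<t)))
∈-units⁻ (suc k) t {u} = mk⇔ to from
  where
  to : u ∈ units minus t (suc k) → shiftBy minus (suc k) t ≤ u × u < t
  to (here refl) = shiftBy⁻≤t k (ℤ.pred t) , pred[t]<t t
  to (there u∈) with Equivalence.to (∈-units⁻ k (ℤ.pred t)) u∈
  ... | end≤u , u<pred[t] = end≤u , ℤ.<-trans u<pred[t] (pred[t]<t t)
  from : shiftBy minus (suc k) t ≤ u × u < t → u ∈ units minus t (suc k)
  from (end≤u , u<t) with u ℤ.≟ ℤ.pred t
  ... | yes refl = here refl
  ... | no u≢pred[t] =
    there (Equivalence.from (∈-units⁻ k (ℤ.pred t)) (end≤u , ℤ.≤∧≢⇒< (ℤ.i<j⇒i≤pred[j] u<t) u≢pred[t]))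

record Segment : Set where
  field
    low high : ℤ
    low<high : low < high
open Segment

Covers : Segment → ℤ → Set
Covers σ u = low σ ≤ u × u < high σ

covers-low : ∀ σ → Covers σ (low σ)
covers-low σ = ℤ.≤-refl , low<high σ

end : Segment → Sign → ℤ
end σ plus = high σ
end σ minus = low σ

runSegment : Sign → ℤ → ℕ → Segment
runSegment plus t k = record { low = t ; high = shiftBy plus (suc k) t ; low<high = t<shiftBy⁺ k t }
runSegment minus t k = record { low = shiftBy minus (suc k) t ; high = t ; low<high = shiftBy⁻<t k t }

∈-runUnits : ∀ s t k {u} → u ∈ units s t (suc k) ⇔ Covers (runSegment s t k) u
∈-runUnits plus t k = ∈-units⁺ (suc k) t
∈-runUnits minus t k = ∈-units⁻ (suc k) t

∈-run : ∀ ax s p k {e} → e ∈ edgesAlong p (run k (ax , s)) ⇔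
  ∃ λ u → e ≡ unitEdge ax u (across ax p) × Covers (runSegment s (along ax p) k) u
∈-run ax s p k {e} rewrite edgesAlong-replicate ax s p (suc k) = mk⇔ to from
  where
  unitEdgeHere : ℤ → GridEdge
  unitEdgeHere u = unitEdge ax u (across ax p)
  to : e ∈ map unitEdgeHere (units s (along ax p) (suc k)) →
       ∃ λ u → e ≡ unitEdgeHere u × Covers (runSegment s (along ax p) k) u
  to e∈ with ∈-map⁻ unitEdgeHere e∈
  ... | u , u∈ , refl = u , refl , Equivalence.to (∈-runUnits s (along ax p) k) u∈
  from : (∃ λ u → e ≡ unitEdgeHere u × Covers (runSegment s (along ax p) k) u) →
         e ∈ map unitEdgeHere (units s (along ax p) (suc k))
  from (u , refl , covers) = ∈-map⁺ unitEdgeHere (Equivalence.from (∈-runUnits s (along ax p) k) covers)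

endpoint-run : ∀ ax s p k →
  endpoint p (run k (ax , s)) ≡ pointAt ax (end (runSegment s (along ax p) k) s) (across ax p)
endpoint-run ax plus p k = endpoint-replicate ax plus p (suc k)
endpoint-run ax minus p k = endpoint-replicate ax minus p (suc k)

start-runSegment : ∀ s t k → end (runSegment s t k) (flip s) ≡ t
start-runSegment plus t k = refl
start-runSegment minus t k = refl

start≢end : ∀ s t k → t ≢ end (runSegment s t k) s
start≢end plus t k = ℤ.<⇒≢ (t<shiftBy⁺ k t)
start≢end minus t k = ℤ.<⇒≢ (shiftBy⁻<t k t) ∘ sym

covers-start⊓end : ∀ s t k → Covers (runSegment s t k) (t ⊓ end (runSegment s t k) s)
covers-start⊓end plus t k rewrite ℤ.i≤j⇒i⊓j≡i (ℤ.<⇒≤ (t<shiftBy⁺ k t)) =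
  covers-low (runSegment plus t k)
covers-start⊓end minus t k rewrite ℤ.i≥j⇒i⊓j≡j (ℤ.<⇒≤ (shiftBy⁻<t k t)) =
  covers-low (runSegment minus t k)

-- Staircases

record RowSegment (E : GridEdge → Set) (column y : ℤ) : Set where
  field
    segment : Segment
    bend : Sign
    bend≡column : end segment bend ≡ column
    covers : ∀ {u} → E (hor u y) ⇔ Covers segment u
open RowSegment

record Staircase (a b : ℤ) (E : GridEdge → Set) : Set where
  field
    column : ℤ
    rowᵃ : RowSegment E column a
    rowᵇ : RowSegment E column b
    rows : ∀ {x y} → E (hor x y) → y ≡ a ⊎ y ≡ b
    inColumn : ∀ {x y} → E (ver x y) → x ≡ column
    crossing : E (ver column (a ⊓ b))
open Staircase

swap : ∀ {a b E} → Staircase a b E → Staircase b a E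
swap {a} {b} {E} st = record
  { column = column st
  ; rowᵃ = rowᵇ st
  ; rowᵇ = rowᵃ st
  ; rows = Data.Sum.swap ∘ rows st
  ; inColumn = inColumn st
  ; crossing = subst (λ y → E (ver (column st) y)) (ℤ.⊓-comm a b) (crossing st)
  }

data StaircaseEdge (r₁ r₂ c : ℤ) (σ₁ τ σ₂ : Segment) : GridEdge → Set where
  first : ∀ {u} → Covers σ₁ u → StaircaseEdge r₁ r₂ c σ₁ τ σ₂ (hor u r₁)
  middle : ∀ {v} → Covers τ v → StaircaseEdge r₁ r₂ c σ₁ τ σ₂ (ver c v)
  last : ∀ {u} → Covers σ₂ u → StaircaseEdge r₁ r₂ c σ₁ τ σ₂ (hor u r₂)

staircase : ∀ {E r₁ r₂ c σ₁ τ σ₂} b₁ b₂ → r₁ ≢ r₂ → Covers τ (r₁ ⊓ r₂) →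
  end σ₁ b₁ ≡ c → end σ₂ b₂ ≡ c → (∀ {e} → E e ⇔ StaircaseEdge r₁ r₂ c σ₁ τ σ₂ e) →
  Staircase r₁ r₂ E
staircase {E} {r₁} {r₂} {c} {σ₁} {τ} {σ₂} b₁ b₂ r₁≢r₂ crossing-covered bend₁ bend₂ E⇔ = record
  { column = c
  ; rowᵃ = record
    { segment = σ₁ ; bend = b₁ ; bend≡column = bend₁ ; covers = mk⇔ on-r₁ (Equivalence.from E⇔ ∘ first) }
  ; rowᵇ = record
    { segment = σ₂ ; bend = b₂ ; bend≡column = bend₂ ; covers = mk⇔ on-r₂ (Equivalence.from E⇔ ∘ last) }
  ; rows = rows' ∘ Equivalence.to E⇔
  ; inColumn = inColumn' ∘ Equivalence.to E⇔
  ; crossing = Equivalence.from E⇔ (middle crossing-covered)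
  }
  where
  edge-r₁ : ∀ {u} → StaircaseEdge r₁ r₂ c σ₁ τ σ₂ (hor u r₁) → Covers σ₁ u
  edge-r₁ (first covered) = covered
  edge-r₁ (last _) = ⊥-elim (r₁≢r₂ refl)
  on-r₁ : ∀ {u} → E (hor u r₁) → Covers σ₁ u
  on-r₁ = edge-r₁ ∘ Equivalence.to E⇔
  edge-r₂ : ∀ {u} → StaircaseEdge r₁ r₂ c σ₁ τ σ₂ (hor u r₂) → Covers σ₂ u
  edge-r₂ (first _) = ⊥-elim (r₁≢r₂ refl)
  edge-r₂ (last covered) = covered
  on-r₂ : ∀ {u} → E (hor u r₂) → Covers σ₂ u
  on-r₂ = edge-r₂ ∘ Equivalence.to E⇔
  rows' : ∀ {x y} → StaircaseEdge r₁ r₂ c σ₁ τ σ₂ (hor x y) → y ≡ r₁ ⊎ y ≡ r₂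
  rows' (first _) = inj₁ refl
  rows' (last _) = inj₂ refl
  inColumn' : ∀ {x y} → StaircaseEdge r₁ r₂ c σ₁ τ σ₂ (ver x y) → x ≡ c
  inColumn' (middle _) = refl

∈-staircaseWord : ∀ x₀ y₀ s₁ s₂ s₃ k₁ k₂ k₃ {e} →
  let σ₁ = runSegment s₁ x₀ k₁
      τ = runSegment s₂ y₀ k₂
      σ₂ = runSegment s₃ (end σ₁ s₁) k₃
  in e ∈ edgesAlong (x₀ , y₀)
           (run k₁ (horizontal , s₁) ++ run k₂ (vertical , s₂) ++ run k₃ (horizontal , s₃)) ⇔
     StaircaseEdge y₀ (end τ s₂) (end σ₁ s₁) σ₁ τ σ₂ e
∈-staircaseWord x₀ y₀ s₁ s₂ s₃ k₁ k₂ k₃ {e}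
  rewrite edgesAlong-++ (x₀ , y₀) (run k₁ (horizontal , s₁))
                        (run k₂ (vertical , s₂) ++ run k₃ (horizontal , s₃))
        | endpoint-run horizontal s₁ (x₀ , y₀) k₁
        | edgesAlong-++ (end (runSegment s₁ x₀ k₁) s₁ , y₀) (run k₂ (vertical , s₂))
                        (run k₃ (horizontal , s₃))
        | endpoint-run vertical s₂ (end (runSegment s₁ x₀ k₁) s₁ , y₀) k₂
  = mk⇔ to from
  where
  x₁ y₁ : ℤ
  x₁ = end (runSegment s₁ x₀ k₁) s₁
  y₁ = end (runSegment s₂ y₀ k₂) s₂
  Edges₁ Edges₂ Edges₃ : List GridEdge
  Edges₁ = edgesAlong (x₀ , y₀) (run k₁ (horizontal , s₁))
  Edges₂ = edgesAlong (x₁ , y₀) (run k₂ (vertical , s₂))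
  Edges₃ = edgesAlong (x₁ , y₁) (run k₃ (horizontal , s₃))
  Target : GridEdge → Set
  Target = StaircaseEdge y₀ y₁ x₁ (runSegment s₁ x₀ k₁) (runSegment s₂ y₀ k₂) (runSegment s₃ x₁ k₃)
  to : e ∈ Edges₁ ++ Edges₂ ++ Edges₃ → Target e
  to e∈ with ∈-++⁻ Edges₁ e∈
  ... | inj₁ e∈₁ with Equivalence.to (∈-run horizontal s₁ (x₀ , y₀) k₁) e∈₁
  ...   | _ , refl , covered = first covered
  to e∈ | inj₂ e∈₂₃ with ∈-++⁻ Edges₂ e∈₂₃
  ... | inj₁ e∈₂ with Equivalence.to (∈-run vertical s₂ (x₁ , y₀) k₂) e∈₂
  ...   | _ , refl , covered = middle covered
  to e∈ | inj₂ e∈₂₃ | inj₂ e∈₃ with Equivalence.to (∈-run horizontal s₃ (x₁ , y₁) k₃) e∈₃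
  ...   | _ , refl , covered = last covered
  from : Target e → e ∈ Edges₁ ++ Edges₂ ++ Edges₃
  from (first covered) =
    ∈-++⁺ˡ (Equivalence.from (∈-run horizontal s₁ (x₀ , y₀) k₁) (_ , refl , covered))
  from (middle covered) =
    ∈-++⁺ʳ Edges₁ (∈-++⁺ˡ (Equivalence.from (∈-run vertical s₂ (x₁ , y₀) k₂) (_ , refl , covered)))
  from (last covered) =
    ∈-++⁺ʳ Edges₁ (∈-++⁺ʳ Edges₂
      (Equivalence.from (∈-run horizontal s₃ (x₁ , y₁) k₃) (_ , refl , covered)))

OnOneRow : (GridEdge → Set) → Set
OnOneRow E = ∃ λ r → ∀ {x y} → E (hor x y) → y ≡ r

NoRow : (GridEdge → Set) → Set
NoRow E = ∀ {x y} → ¬ E (hor x y)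

verticalRun-noRow : ∀ s p k → NoRow (_∈ edgesAlong p (run k (vertical , s)))
verticalRun-noRow s p k e∈ with Equivalence.to (∈-run vertical s p k) e∈
... | _ , () , _

run-onOneRow : ∀ ax s p k → OnOneRow (_∈ edgesAlong p (run k (ax , s)))
run-onOneRow horizontal s p k = proj₂ p , onRow
  where
  onRow : ∀ {x y} → hor x y ∈ edgesAlong p (run k (horizontal , s)) → y ≡ proj₂ p
  onRow e∈ with Equivalence.to (∈-run horizontal s p k) e∈
  ... | _ , refl , _ = refl
run-onOneRow vertical s p k = proj₂ p , ⊥-elim ∘ verticalRun-noRow s p k

onOneRow-++ˡ : ∀ {xs ys} → OnOneRow (_∈ xs) → NoRow (_∈ ys) → OnOneRow (_∈ xs ++ ys)
onOneRow-++ˡ {xs} (r , onRow) noRow = r , λ e∈ → Data.Sum.[ onRow , ⊥-elim ∘ noRow ] (∈-++⁻ xs e∈)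

onOneRow-++ʳ : ∀ {xs ys} → NoRow (_∈ xs) → OnOneRow (_∈ ys) → OnOneRow (_∈ xs ++ ys)
onOneRow-++ʳ {xs} noRow (r , onRow) = r , λ e∈ → Data.Sum.[ ⊥-elim ∘ noRow , onRow ] (∈-++⁻ xs e∈)

onOneRow-⊆ : ∀ {E F : GridEdge → Set} → (∀ {e} → E e → F e) → OnOneRow F → OnOneRow E
onOneRow-⊆ E⊆F (r , onRow) = r , onRow ∘ E⊆F

twoRuns-onOneRow : ∀ ax s₁ s₂ k₁ k₂ p →
  OnOneRow (_∈ edgesAlong p (run k₁ (ax , s₁) ++ run k₂ (other ax , s₂)))
twoRuns-onOneRow horizontal s₁ s₂ k₁ k₂ p
  rewrite edgesAlong-++ p (run k₁ (horizontal , s₁)) (run k₂ (vertical , s₂)) =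
  onOneRow-++ˡ (run-onOneRow horizontal s₁ p k₁) (verticalRun-noRow s₂ _ k₂)
twoRuns-onOneRow vertical s₁ s₂ k₁ k₂ p
  rewrite edgesAlong-++ p (run k₁ (vertical , s₁)) (run k₂ (horizontal , s₂)) =
  onOneRow-++ʳ (verticalRun-noRow s₁ p k₁) (run-onOneRow horizontal s₂ _ k₂)

verticalStaircase-onOneRow : ∀ s₁ s₂ s₃ k₁ k₂ k₃ p →
  OnOneRow (_∈ edgesAlong p
    (run k₁ (vertical , s₁) ++ run k₂ (horizontal , s₂) ++ run k₃ (vertical , s₃)))
verticalStaircase-onOneRow s₁ s₂ s₃ k₁ k₂ k₃ p
  rewrite edgesAlong-++ p (run k₁ (vertical , s₁)) (run k₂ (horizontal , s₂) ++ run k₃ (vertical , s₃)) =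
  onOneRow-++ʳ (verticalRun-noRow s₁ p k₁) (twoRuns-onOneRow horizontal s₂ s₃ k₂ k₃ _)

StaircaseOrOneRow : (GridEdge → Set) → Set
StaircaseOrOneRow E = (∃₂ λ r₁ r₂ → Staircase r₁ r₂ E) ⊎ OnOneRow E

wordShape : ∀ {E} p ds → AtMostThreeRuns ds → (∀ {e} → E e ⇔ e ∈ edgesAlong p ds) → StaircaseOrOneRow E
wordShape p _ none E⇔ = inj₂ (proj₂ p , λ e∈ → case Equivalence.to E⇔ e∈ of λ ())
wordShape p _ (one ax s k) E⇔ =
  inj₂ (onOneRow-⊆ (λ {e} → Equivalence.to (E⇔ {e})) (run-onOneRow ax s p k))
wordShape p _ (two ax s₁ s₂ k₁ k₂) E⇔ =
  inj₂ (onOneRow-⊆ (λ {e} → Equivalence.to (E⇔ {e})) (twoRuns-onOneRow ax s₁ s₂ k₁ k₂ p))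
wordShape p _ (three vertical s₁ s₂ s₃ k₁ k₂ k₃) E⇔ =
  inj₂ (onOneRow-⊆ (λ {e} → Equivalence.to (E⇔ {e})) (verticalStaircase-onOneRow s₁ s₂ s₃ k₁ k₂ k₃ p))
wordShape (x₀ , y₀) _ (three horizontal s₁ s₂ s₃ k₁ k₂ k₃) E⇔ =
  inj₁ (y₀ , _ ,
        staircase s₁ (flip s₃) (start≢end s₂ y₀ k₂) (covers-start⊓end s₂ y₀ k₂)
          refl (start-runSegment s₃ _ k₃) (⇔-trans E⇔ (∈-staircaseWord x₀ y₀ s₁ s₂ s₃ k₁ k₂ k₃)))

pointsShape : ∀ ps → Linked GridAdj ps → Unique ps → bendsList ps ℕ.≤ 2 → StaircaseOrOneRow (HasEdge ps)
pointsShape [] _ _ _ = inj₂ (ℤ.0ℤ , λ ())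
pointsShape (p ∷ ps) linked unique bounded with linked⇒trace linked
... | ds , refl = wordShape p ds runs (hasEdge⇔∈ p ds)
  where
  runs : AtMostThreeRuns ds
  runs = atMostThreeRuns ds (unique⇒noReversal p ds unique)
           (subst (ℕ._≤ 2) (bendsList-trace p ds) bounded)

pathShape : ∀ P → bends P ℕ.≤ 2 → StaircaseOrOneRow (ContainsEdge P)
pathShape P = pointsShape (points P) (linked P) (simple P)

-- Segments as intervals

double : ℤ → ℤ
double t = ℤ.+ 2 ℤ.* t

double-< : ∀ {l h} → l < h → double l < double h
double-< = ℤ.*-monoˡ-<-pos (ℤ.+ 2)

double-<⁻¹ : ∀ {l h} → double l < double h → l < h
double-<⁻¹ = ℤ.*-cancelˡ-<-nonNeg (ℤ.+ 2)

double-≤ : ∀ {l h} → l ≤ h → double l ≤ double h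
double-≤ = ℤ.*-monoˡ-≤-nonNeg (ℤ.+ 2)

double-≤⁻¹ : ∀ {l h} → double l ≤ double h → l ≤ h
double-≤⁻¹ {l} {h} = ℤ.*-cancelˡ-≤-pos l h (ℤ.+ 2)

double-suc : ∀ t → double (ℤ.suc t) ≡ ℤ.suc (ℤ.suc (double t))
double-suc t = trans (ℤ.*-suc (ℤ.+ 2) t) (ℤ.+-assoc ℤ.1ℤ ℤ.1ℤ (double t))

≤⇒<⊎≡ : ∀ {l h} → l ≤ h → l < h ⊎ l ≡ h
≤⇒<⊎≡ {l} {h} l≤h with l ℤ.≟ h
... | yes l≡h = inj₂ l≡h
... | no l≢h = inj₁ (ℤ.≤∧≢⇒< l≤h l≢h)

-- Endpoints, in doubled coordinates, of the interval of a segment bending at its end b: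
-- the free end is pulled in by half a unit.
lowerEnd upperEnd : Sign → ℤ → ℤ
lowerEnd minus l = double l
lowerEnd plus l = ℤ.suc (double l)
upperEnd minus h = ℤ.pred (double h)
upperEnd plus h = double h

lowerEnd≤upperEnd : ∀ s t {l h} → l < h → lowerEnd s l ≤ upperEnd t h
lowerEnd≤upperEnd minus minus l<h = ℤ.i<j⇒i≤pred[j] (double-< l<h)
lowerEnd≤upperEnd minus plus l<h = ℤ.<⇒≤ (double-< l<h)
lowerEnd≤upperEnd plus minus {l} {h} l<h =
  ℤ.i<j⇒i≤pred[j] (ℤ.suc[i]≤j⇒i<j (subst (_≤ double h) (double-suc l) (double-≤ (ℤ.i<j⇒suc[i]≤j l<h))))
lowerEnd≤upperEnd plus plus l<h = ℤ.i<j⇒suc[i]≤j (double-< l<h)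

lowerEnd≤upperEnd⁻¹ : ∀ s t {l h} → lowerEnd s l ≤ upperEnd t h →
  l < h ⊎ (s ≡ minus × t ≡ plus × l ≡ h)
lowerEnd≤upperEnd⁻¹ minus minus le = inj₁ (double-<⁻¹ (ℤ.i≤pred[j]⇒i<j le))
lowerEnd≤upperEnd⁻¹ minus plus le with ≤⇒<⊎≡ (double-≤⁻¹ le)
... | inj₁ l<h = inj₁ l<h
... | inj₂ l≡h = inj₂ (refl , refl , l≡h)
lowerEnd≤upperEnd⁻¹ plus minus le =
  inj₁ (double-<⁻¹ (ℤ.<-trans (t<suc[t] _) (ℤ.i≤pred[j]⇒i<j le)))
lowerEnd≤upperEnd⁻¹ plus plus le = inj₁ (double-<⁻¹ (ℤ.suc[i]≤j⇒i<j le))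

segmentInterval : Segment → Sign → Interval
segmentInterval σ b = [ lowerEnd b (low σ) , upperEnd b (high σ) ]⟨ lowerEnd≤upperEnd b b (low<high σ) ⟩

CommonUnit : Segment → Segment → Set
CommonUnit σ σ' = ∃ λ u → Covers σ u × Covers σ' u

commonUnit⇔ : ∀ σ σ' → CommonUnit σ σ' ⇔ (low σ < high σ' × low σ' < high σ)
commonUnit⇔ σ σ' = mk⇔ to from
  where
  to : CommonUnit σ σ' → low σ < high σ' × low σ' < high σ
  to (u , (l≤u , u<h) , (l'≤u , u<h')) = ℤ.≤-<-trans l≤u u<h' , ℤ.≤-<-trans l'≤u u<h
  from : low σ < high σ' × low σ' < high σ → CommonUnit σ σ'
  from (l<h' , l'<h) with ℤ.≤-total (low σ) (low σ')
  ... | inj₁ l≤l' = low σ' , (l≤l' , l'<h) , covers-low σ'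
  ... | inj₂ l'≤l = low σ , covers-low σ , (l'≤l , l<h')

sameBend⇒overlap : ∀ σ b σ' b' → end σ b ≡ end σ' b' →
  Overlap (segmentInterval σ b) (segmentInterval σ' b')
sameBend⇒overlap σ minus σ' minus bends≡ =
  lowerEnd≤upperEnd minus minus (subst (_< high σ') (sym bends≡) (low<high σ')) ,
  lowerEnd≤upperEnd minus minus (subst (_< high σ) bends≡ (low<high σ))
sameBend⇒overlap σ plus σ' plus bends≡ =
  lowerEnd≤upperEnd plus plus (subst (low σ <_) bends≡ (low<high σ)) ,
  lowerEnd≤upperEnd plus plus (subst (low σ' <_) (sym bends≡) (low<high σ'))
sameBend⇒overlap σ minus σ' plus bends≡ =
  ℤ.≤-reflexive (cong double bends≡) ,
  lowerEnd≤upperEnd plus minus (ℤ.<-trans (low<high σ') (subst (_< high σ) bends≡ (low<high σ)))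
sameBend⇒overlap σ plus σ' minus bends≡ =
  lowerEnd≤upperEnd plus minus (ℤ.<-trans (low<high σ) (subst (_< high σ') (sym bends≡) (low<high σ'))) ,
  ℤ.≤-reflexive (cong double (sym bends≡))

overlap⇔ : ∀ σ b σ' b' →
  Overlap (segmentInterval σ b) (segmentInterval σ' b') ⇔ (CommonUnit σ σ' ⊎ end σ b ≡ end σ' b')
overlap⇔ σ b σ' b' = mk⇔ to from
  where
  to : Overlap (segmentInterval σ b) (segmentInterval σ' b') → CommonUnit σ σ' ⊎ end σ b ≡ end σ' b'
  to (le , le') with lowerEnd≤upperEnd⁻¹ b b' le | lowerEnd≤upperEnd⁻¹ b' b le'
  ... | inj₁ l<h' | inj₁ l'<h = inj₁ (Equivalence.from (commonUnit⇔ σ σ') (l<h' , l'<h))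
  ... | inj₂ (refl , refl , l≡h') | _ = inj₂ l≡h'
  ... | inj₁ _ | inj₂ (refl , refl , l'≡h) = inj₂ (sym l'≡h)
  from : CommonUnit σ σ' ⊎ end σ b ≡ end σ' b' → Overlap (segmentInterval σ b) (segmentInterval σ' b')
  from (inj₁ common) with Equivalence.to (commonUnit⇔ σ σ') common
  ... | l<h' , l'<h = lowerEnd≤upperEnd b b' l<h' , lowerEnd≤upperEnd b' b l'<h
  from (inj₂ bends≡) = sameBend⇒overlap σ b σ' b' bends≡

rowInterval : ∀ {E c y} → RowSegment E c y → Interval
rowInterval r = segmentInterval (segment r) (bend r)

SharedUnit : ∀ {E E' c c' y} → RowSegment E c y → RowSegment E' c' y → Set
SharedUnit r r' = CommonUnit (segment r) (segment r')

rowInterval-overlap⇔ : ∀ {E E' c c' y} (r : RowSegment E c y) (r' : RowSegment E' c' y) →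
  Overlap (rowInterval r) (rowInterval r') ⇔ (SharedUnit r r' ⊎ c ≡ c')
rowInterval-overlap⇔ r r' =
  ⇔-trans (overlap⇔ (segment r) (bend r) (segment r') (bend r'))
    (⇔-refl ⊎-⇔ mk⇔ (λ eq → trans (sym (bend≡column r)) (trans eq (bend≡column r')))
                    (λ eq → trans (bend≡column r) (trans eq (sym (bend≡column r')))))

SharesEdge : (GridEdge → Set) → (GridEdge → Set) → Set
SharesEdge E E' = ∃ λ e → E e × E' e

sharesEdge⇔ : ∀ {a b E E'} (st : Staircase a b E) (st' : Staircase a b E') →
  SharesEdge E E' ⇔
  ((SharedUnit (rowᵃ st) (rowᵃ st') ⊎ SharedUnit (rowᵇ st) (rowᵇ st')) ⊎ column st ≡ column st')
sharesEdge⇔ {a} {b} {E} {E'} st st' = mk⇔ to from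
  where
  Shared : Set
  Shared = (SharedUnit (rowᵃ st) (rowᵃ st') ⊎ SharedUnit (rowᵇ st) (rowᵇ st')) ⊎ column st ≡ column st'
  unitShared : ∀ {c c' y u} (r : RowSegment E c y) (r' : RowSegment E' c' y) →
    E (hor u y) → E' (hor u y) → SharedUnit r r'
  unitShared r r' e e' = _ , Equivalence.to (covers r) e , Equivalence.to (covers r') e'
  edgeShared : ∀ {c c' y} (r : RowSegment E c y) (r' : RowSegment E' c' y) → SharedUnit r r' → SharesEdge E E'
  edgeShared {y = y} r r' (u , c , c') = hor u y , Equivalence.from (covers r) c , Equivalence.from (covers r') c'
  to : SharesEdge E E' → Shared
  to (hor x y , e , e') with rows st e
  ... | inj₁ refl = inj₁ (inj₁ (unitShared (rowᵃ st) (rowᵃ st') e e'))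
  ... | inj₂ refl = inj₁ (inj₂ (unitShared (rowᵇ st) (rowᵇ st') e e'))
  to (ver x y , e , e') = inj₂ (trans (sym (inColumn st e)) (inColumn st' e'))
  from : Shared → SharesEdge E E'
  from (inj₁ (inj₁ shared)) = edgeShared (rowᵃ st) (rowᵃ st') shared
  from (inj₁ (inj₂ shared)) = edgeShared (rowᵇ st) (rowᵇ st') shared
  from (inj₂ columns≡) =
    ver (column st) (a ⊓ b) , crossing st , subst (λ x → E' (ver x (a ⊓ b))) (sym columns≡) (crossing st')

-- Track 1 carries the segment on row a and track 2 the one on row b; a path on a single row is
-- never in G_ab, so its intervals are irrelevant.
trackIntervals : ∀ {E} → ℤ → StaircaseOrOneRow E → Interval × Interval
trackIntervals a (inj₁ (r₁ , _ , st)) with r₁ ℤ.≟ a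
... | yes _ = rowInterval (rowᵃ st) , rowInterval (rowᵇ st)
... | no _ = rowInterval (rowᵇ st) , rowInterval (rowᵃ st)
trackIntervals a (inj₂ _) = point , point
  where
  point : Interval
  point = [ ℤ.0ℤ , ℤ.0ℤ ]⟨ ℤ.≤-refl ⟩

trackIntervals-staircase : ∀ {E a b} → a ≢ b → (shape : StaircaseOrOneRow E) →
  (∃ λ x → E (hor x a)) → (∃ λ x → E (hor x b)) →
  Σ (Staircase a b E) λ st → trackIntervals a shape ≡ (rowInterval (rowᵃ st) , rowInterval (rowᵇ st))
trackIntervals-staircase a≢b (inj₂ (r , onRow)) (_ , on-a) (_ , on-b) =
  ⊥-elim (a≢b (trans (onRow on-a) (sym (onRow on-b))))
trackIntervals-staircase {a = a} a≢b (inj₁ (r₁ , _ , st)) (_ , on-a) (_ , on-b)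
  with r₁ ℤ.≟ a | rows st on-a | rows st on-b
... | yes refl | _ | inj₁ refl = ⊥-elim (a≢b refl)
... | yes refl | _ | inj₂ refl = st , refl
... | no r₁≢a | inj₁ refl | _ = ⊥-elim (r₁≢a refl)
... | no _ | inj₂ refl | inj₁ refl = swap st , refl
... | no _ | inj₂ refl | inj₂ refl = ⊥-elim (a≢b refl)

⊎-distribʳ-⊎ : ∀ {A B C : Set} → ((A ⊎ B) ⊎ C) ⇔ ((A ⊎ C) ⊎ (B ⊎ C))
⊎-distribʳ-⊎ = mk⇔ Data.Sum.[ Data.Sum.[ inj₁ ∘ inj₁ , inj₂ ∘ inj₁ ] , inj₁ ∘ inj₂ ]
                   Data.Sum.[ Data.Sum.[ inj₁ ∘ inj₁ , inj₂ ] , Data.Sum.[ inj₁ ∘ inj₂ , inj₂ ] ]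

mainTheorem5 : (G : Graph) (R : EPGRep G) → IsBkRep 2 R →
    (a b : ℤ) → a ≢ b →
    InducedIsTwoTrackInterval G (λ u → IndexIs R u a b)
mainTheorem5 G R twoBends a b a≢b = proj₁ ∘ tracks , proj₂ ∘ tracks , adjacency
  where
  shape : ∀ u → StaircaseOrOneRow (ContainsEdge (path R u))
  shape u = pathShape (path R u) (twoBends u)
  tracks : Fin (n G) → Interval × Interval
  tracks u = trackIntervals a (shape u)
  staircaseOf : ∀ u → IndexIs R u a b → Σ (Staircase a b (ContainsEdge (path R u))) λ st →
    tracks u ≡ (rowInterval (rowᵃ st) , rowInterval (rowᵇ st))
  staircaseOf u index = trackIntervals-staircase a≢b (shape u)
    (Equivalence.from (index a) (inj₁ refl)) (Equivalence.from (index b) (inj₂ refl))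
  adjacency : ∀ u v → IndexIs R u a b → IndexIs R v a b → u ≢ v →
    Adj G u v ⇔
    (Overlap (proj₁ (tracks u)) (proj₁ (tracks v)) ⊎ Overlap (proj₂ (tracks u)) (proj₂ (tracks v)))
  adjacency u v index-u index-v u≢v with staircaseOf u index-u | staircaseOf v index-v
  ... | st , tracks-u | st' , tracks-v rewrite tracks-u | tracks-v =
    ⇔-trans (correct R u v u≢v) (⇔-trans (sharesEdge⇔ st st') (⇔-trans ⊎-distribʳ-⊎
      (⇔-sym (rowInterval-overlap⇔ (rowᵃ st) (rowᵃ st')) ⊎-⇔
       ⇔-sym (rowInterval-overlap⇔ (rowᵇ st) (rowᵇ st')))))
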